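{- Let $\mathcal{C}$ be a frieze with coefficients on an $n$-gon over the positive integers, and assume that for every triangle in $\mathcal{C}$ with side labels $a,b,c$ we have $\gcd(a,b)=\gcd(b,c)=\gcd(a,c)$. Then there exist a Conway-Coxeter frieze $\mathcal{E}$ and a positive integer $k$ such that $\mathcal{C}$ is a subpolygon of $k\cdot\mathcal{E}$.
   Context: Label the vertices of a regular $n$-gon by $0,\dots,n-1$ in cyclic order. A frieze with coefficients on the $n$-gon over a set $R$ is a map assigning to each edge or diagonal $\{i,j\}$ a value $c_{i,j}=c_{j,i}\in R$ such that $c_{i,k}c_{j,\ell}=c_{i,\ell}c_{j,k}+c_{i,j}c_{k,\ell}$ for all vertices $i<j<k<\ell$. A subpolygon on a vertex subset $S$ is the restriction to edges and diagonals between vertices of $S$ (with inherited cyclic order); a triangle is a 3-subpolygon, with side labels its three values. A Conway-Coxeter frieze is a frieze with coefficients over the positive integers on some polygon whose boundary edges all have label $1$. For a frieze with coefficients $\mathcal{E}$ and a positive integer $k$, $k\cdot\mathcal{E}$ is the frieze with coefficients obtained by multiplying every label of $\mathcal{E}$ by $k$. -}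

module Defs where

open import Data.Nat using (ℕ; suc; _+_; _*_; _∸_; _<_)
open import Data.Nat.GCD using (gcd)
open import Data.Fin using (Fin; toℕ) renaming (_<_ to _<ᶠ_)
open import Data.Product using (Σ; _×_)
open import Data.Sum using (_⊎_)
open import Relation.Binary.PropositionalEquality using (_≡_; _≢_)

-- A labelling of the edges and diagonals of the n-gon (vertices Fin n).
-- The value at a pair (i , i) is irrelevant: no condition refers to it.
Labelling : ℕ → Set
Labelling n = Fin n → Fin n → ℕ

record IsFrieze (n : ℕ) (c : Labelling n) : Set where
  field
    symmetric : ∀ i j → i ≢ j → c i j ≡ c j i
    positive  : ∀ i j → i ≢ j → 0 < c i j
    ptolemy   : ∀ i j k l → i <ᶠ j → j <ᶠ k → k <ᶠ l →
                c i k * c j l ≡ c i l * c j k + c i j * c k l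

TriangleGcdCondition : (n : ℕ) → Labelling n → Set
TriangleGcdCondition n c =
  ∀ i j k → i <ᶠ j → j <ᶠ k →
    (gcd (c i j) (c j k) ≡ gcd (c j k) (c i k)) ×
    (gcd (c j k) (c i k) ≡ gcd (c i j) (c i k))

IsBoundaryEdge : (m : ℕ) → Fin m → Fin m → Set
IsBoundaryEdge m i j =
  (toℕ j ≡ suc (toℕ i)) ⊎ ((toℕ i ≡ 0) × (toℕ j ≡ m ∸ 1))

record IsConwayCoxeter (m : ℕ) (e : Labelling m) : Set where
  field
    frieze   : IsFrieze m e
    boundary : ∀ i j → IsBoundaryEdge m i j → e i j ≡ 1

scale : {m : ℕ} → ℕ → Labelling m → Labelling m
scale k e i j = k * e i j

-- c (on the n-gon) is the subpolygon of d (on the m-gon) on the vertex set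
-- given by an order-preserving injection f (inherited cyclic order),
-- i.e. c is the restriction of d along f on all edges and diagonals.
IsSubpolygonOf : {n m : ℕ} → Labelling n → Labelling m → Set
IsSubpolygonOf {n} {m} c d =
  Σ (Fin n → Fin m) λ f →
    (∀ i j → i <ᶠ j → f i <ᶠ f j) ×
    (∀ i j → i ≢ j → c i j ≡ d (f i) (f j))

-- Antisymmetrising C gives a skew-symmetric integer matrix satisfying the three-term
-- Plücker relations (these are the Ptolemy relations). Those through the edge {0, 1} say
-- that C₀₁ · C is the matrix of 2 × 2 minors of the first two rows of C. Passing to a basis
-- of the lattice spanned by the columns of these rows gives C i j = k · det (u i) (u j)
-- with k > 0, vectors u i ∈ ℤ² spanning ℤ², and det (u i) (u j) > 0 for i < j. The gcd
-- condition on triangles forces every u i to be primitive. Between consecutive primitive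
-- vectors one inserts the Farey chain of vectors with consecutive determinants 1; doing
-- this all around u 0, …, u (n-1), −u 0 yields a convex unimodular polygon of vectors whose
-- absolute determinants form a Conway–Coxeter frieze E, in which the u i form a
-- subpolygon with C = k · E.

module Submission where

open import Data.Empty using (⊥-elim)
open import Data.Fin as Fin using (Fin; zero; suc; toℕ)
import Data.Fin.Properties as Finₚ
open import Data.Integer as ℤ using (ℤ; +_; -[1+_]; +[1+_]; _+_; _*_; _-_; -_; ∣_∣)
open import Data.Integer.DivMod using (_/ℕ_; _%ℕ_; n%ℕd<d; a≡a%ℕn+[a/ℕn]*n)
open import Data.Integer.Divisibility.Signed
  using (_∣_; divides; ∣ᵤ⇒∣; ∣⇒∣ᵤ; ∣m∣n⇒∣m+n; ∣m∣n⇒∣m-n; ∣m⇒∣-m; ∣m⇒∣m*n; ∣n⇒∣m*n; *-monoʳ-∣; *-cancelˡ-∣)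
import Data.Integer.Properties as ℤₚ
open import Data.Integer.Tactic.RingSolver using (solve-∀)
open import Data.List using (List; []; _∷_; _++_; [_]; length)
import Data.List.Properties as Listₚ
open import Data.List.Relation.Unary.All as All using (All; []; _∷_)
import Data.List.Relation.Unary.All.Properties as Allₚ
open import Data.List.Relation.Unary.AllPairs as AllPairs using (AllPairs; []; _∷_)
open import Data.List.Relation.Unary.Linked as Linked using (Linked; []; [-]; _∷_)
open import Data.List.Relation.Unary.Linked.Properties using (Linked⇒AllPairs)
open import Data.Nat as ℕ using (ℕ; zero; suc; s≤s; z≤n)
open import Data.Nat.Divisibility using () renaming (_∣_ to _∣ℕ_; ∣-trans to ∣ℕ-trans)
import Data.Nat.GCD as ℕ-GCD
open import Data.Nat.Induction using (<-rec)
import Data.Nat.Properties as ℕₚ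
open import Data.Product using (Σ; ∃; _×_; _,_; proj₁; proj₂; swap)
open import Data.Sum using (_⊎_; inj₁; inj₂)
open import Function using (_∘_)
open import Relation.Binary using (tri<; tri≈; tri>)
open import Relation.Binary.PropositionalEquality hiding ([_])
open import Relation.Nullary using (yes; no)
open import Defs

open import Algebra.Properties.Semiring.Sum ℤₚ.+-*-semiring
  using (sum; sum-cong-≗; ∑-distrib-+; *-distribˡ-sum; *-distribʳ-sum)
open ≡-Reasoning

ℤ² : Set
ℤ² = ℤ × ℤ

det : ℤ² → ℤ² → ℤ
det (a , b) (c , d) = a * d - b * c

negate : ℤ² → ℤ²
negate (a , b) = - a , - b

det-antisym : ∀ x y → det y x ≡ - det x y
det-antisym (a , b) (c , d) = lemma a b c d
  where
  lemma : ∀ a b c d → c * b - d * a ≡ - (a * d - b * c)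
  lemma = solve-∀

det-self : ∀ x → det x x ≡ + 0
det-self (a , b) = lemma a b
  where
  lemma : ∀ a b → a * b - b * a ≡ + 0
  lemma = solve-∀

det-swap : ∀ x y → det (swap x) (swap y) ≡ - det x y
det-swap (a , b) (c , d) = lemma a b c d
  where
  lemma : ∀ a b c d → b * c - a * d ≡ - (a * d - b * c)
  lemma = solve-∀

det-negate : ∀ x y → det (negate x) (negate y) ≡ det x y
det-negate (a , b) (c , d) = lemma a b c d
  where
  lemma : ∀ a b c d → (- a) * (- d) - (- b) * (- c) ≡ a * d - b * c
  lemma = solve-∀

det-negateʳ : ∀ x y → det x (negate y) ≡ det y x
det-negateʳ (a , b) (c , d) = lemma a b c d
  where
  lemma : ∀ a b c d → a * (- d) - b * (- c) ≡ c * b - d * a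
  lemma = solve-∀

plücker : ∀ a b c d → det a c * det b d ≡ det a d * det b c + det a b * det c d
plücker (a₁ , a₂) (b₁ , b₂) (c₁ , c₂) (d₁ , d₂) = lemma a₁ a₂ b₁ b₂ c₁ c₂ d₁ d₂
  where
  lemma : ∀ a₁ a₂ b₁ b₂ c₁ c₂ d₁ d₂ →
    (a₁ * c₂ - a₂ * c₁) * (b₁ * d₂ - b₂ * d₁) ≡
    (a₁ * d₂ - a₂ * d₁) * (b₁ * c₂ - b₂ * c₁) + (a₁ * b₂ - a₂ * b₁) * (c₁ * d₂ - c₂ * d₁)
  lemma = solve-∀

Primitive : ℤ² → Set
Primitive v = ∃ λ z → det v z ≡ + 1

primitive-negate : ∀ {v} → Primitive v → Primitive (negate v)
primitive-negate {v} (z , det≡1) = negate z , trans (det-negate v z) det≡1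

combination : ∀ {n} → (Fin n → ℤ) → (Fin n → ℤ²) → ℤ²
combination a u = sum (λ j → a j * proj₁ (u j)) , sum (λ j → a j * proj₂ (u j))

det-combinationˡ : ∀ {n} a (u : Fin n → ℤ²) w →
  det (combination a u) w ≡ sum (λ j → a j * det (u j) w)
det-combinationˡ {zero} a u (w₁ , w₂) = lemma w₁ w₂
  where
  lemma : ∀ w₁ w₂ → + 0 * w₂ - + 0 * w₁ ≡ + 0
  lemma = solve-∀
det-combinationˡ {suc n} a u w@(w₁ , w₂) =
  trans (expand (a zero) (proj₁ (u zero)) (proj₂ (u zero)) _ _ w₁ w₂)
        (cong (λ s → a zero * det (u zero) w + s) (det-combinationˡ (a ∘ suc) (u ∘ suc) w))
  where
  expand : ∀ a x y S T w₁ w₂ →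
    (a * x + S) * w₂ - (a * y + T) * w₁ ≡ a * (x * w₂ - y * w₁) + (S * w₂ - T * w₁)
  expand = solve-∀

det-combinationʳ : ∀ {n} a (u : Fin n → ℤ²) w →
  det w (combination a u) ≡ sum (λ j → a j * det w (u j))
det-combinationʳ {zero} a u (w₁ , w₂) = lemma w₁ w₂
  where
  lemma : ∀ w₁ w₂ → w₁ * + 0 - w₂ * + 0 ≡ + 0
  lemma = solve-∀
det-combinationʳ {suc n} a u w@(w₁ , w₂) =
  trans (expand (a zero) (proj₁ (u zero)) (proj₂ (u zero)) _ _ w₁ w₂)
        (cong (λ s → a zero * det w (u zero) + s) (det-combinationʳ (a ∘ suc) (u ∘ suc) w))
  where
  expand : ∀ a x y S T w₁ w₂ →
    w₁ * (a * y + T) - w₂ * (a * x + S) ≡ a * (w₁ * y - w₂ * x) + (w₁ * T - w₂ * S)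
  expand = solve-∀

Pos : ℤ → Set
Pos x = ∃ λ k → x ≡ +[1+ k ]

NonNeg : ℤ → Set
NonNeg x = ∃ λ k → x ≡ + k

pos⇒nonNeg : ∀ {a} → Pos a → NonNeg a
pos⇒nonNeg (k , a≡) = suc k , a≡

pos*pos : ∀ {a b} → Pos a → Pos b → Pos (a * b)
pos*pos (k , refl) (l , refl) = l ℕ.+ k ℕ.* suc l , sym (ℤₚ.pos-* (suc k) (suc l))

nonNeg*nonNeg : ∀ {a b} → NonNeg a → NonNeg b → NonNeg (a * b)
nonNeg*nonNeg (k , refl) (l , refl) = k ℕ.* l , sym (ℤₚ.pos-* k l)

pos+nonNeg : ∀ {a b} → Pos a → NonNeg b → Pos (a + b)
pos+nonNeg (k , refl) (l , refl) = k ℕ.+ l , sym (ℤₚ.pos-+ (suc k) l)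

pos-*+* : ∀ a b c d → + (a ℕ.* b ℕ.+ c ℕ.* d) ≡ + a * + b + + c * + d
pos-*+* a b c d = trans (ℤₚ.pos-+ (a ℕ.* b) (c ℕ.* d)) (cong₂ _+_ (ℤₚ.pos-* a b) (ℤₚ.pos-* c d))

pos-cancelˡ : ∀ {a b} → Pos a → Pos (a * b) → Pos b
pos-cancelˡ {.(+[1+ k ])} {+ zero}    (k , refl) (_ , ab≡) =
  ⊥-elim (ℕₚ.0≢1+n (ℤₚ.+-injective (trans (sym (ℤₚ.*-zeroʳ +[1+ k ])) ab≡)))
pos-cancelˡ {.(+[1+ k ])} {+[1+ m ]}  (k , refl) _         = m , refl
pos-cancelˡ {.(+[1+ k ])} { -[1+ m ]} (k , refl) (_ , ())

pos-cancelʳ : ∀ {a b} → Pos b → Pos (a * b) → Pos a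
pos-cancelʳ {a} {b} pos-b pos-ab = pos-cancelˡ pos-b (subst Pos (ℤₚ.*-comm a b) pos-ab)

Unimodular : ℤ² → ℤ² → Set
Unimodular x y = det x y ≡ + 1

PosDet : ℤ² → ℤ² → Set
PosDet x y = Pos (det x y)

-- By the Plücker relation, det y z · det o x = det o z · det y x + det o y · det x z.
between-positive : ∀ o x y z → PosDet y z → NonNeg (det o y) → NonNeg (det o z) →
  PosDet o y ⊎ PosDet o z → PosDet y x → PosDet x z → PosDet o x
between-positive o x y z pos-yz nn-oy nn-oz strict pos-yx pos-xz =
  pos-cancelʳ pos-yz (subst Pos (sym (plücker o y x z)) (sum-positive strict))
  where
  sum-positive : PosDet o y ⊎ PosDet o z → Pos (det o z * det y x + det o y * det x z)
  sum-positive (inj₁ pos-oy) = subst Pos (ℤₚ.+-comm (det o y * det x z) (det o z * det y x))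
    (pos+nonNeg (pos*pos pos-oy pos-xz) (nonNeg*nonNeg nn-oz (pos⇒nonNeg pos-yx)))
  sum-positive (inj₂ pos-oz) =
    pos+nonNeg (pos*pos pos-oz pos-yx) (nonNeg*nonNeg nn-oy (pos⇒nonNeg pos-xz))

posDet-trans : ∀ o x y z → PosDet o x → PosDet o y → PosDet o z → PosDet x y → PosDet y z → PosDet x z
posDet-trans o x y z pos-ox pos-oy pos-oz pos-xy pos-yz =
  pos-cancelˡ pos-oy (subst Pos (sym (plücker o x y z))
    (pos+nonNeg (pos*pos pos-oz pos-xy) (pos⇒nonNeg (pos*pos pos-ox pos-yz))))

-- Bézout identities

signum : ℤ → ℤ
signum (+ _)    = + 1
signum -[1+ _ ] = - + 1

abs-≡-signum-* : ∀ x → + ∣ x ∣ ≡ signum x * x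
abs-≡-signum-* (+ n)    = sym (ℤₚ.*-identityˡ (+ n))
abs-≡-signum-* -[1+ n ] = cong +[1+_] (sym (ℕₚ.+-identityʳ n))

cast-identity : ∀ {d a m b n} → d ℕ.+ a ℕ.* m ≡ b ℕ.* n → + d ≡ + b * + n - + a * + m
cast-identity {d} {a} {m} {b} {n} eq = begin
  + d                               ≡⟨ lemma (+ d) (+ a * + m) ⟩
  + d + + a * + m - + a * + m       ≡⟨ cong (_- + a * + m) lifted ⟩
  + b * + n - + a * + m             ∎
  where
  lemma : ∀ D X → D ≡ D + X - X
  lemma = solve-∀
  lifted : + d + + a * + m ≡ + b * + n
  lifted = begin
    + d + + a * + m       ≡⟨ cong (λ e → + d + e) (ℤₚ.pos-* a m) ⟨
    + d + + (a ℕ.* m)     ≡⟨ ℤₚ.pos-+ d (a ℕ.* m) ⟨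
    + (d ℕ.+ a ℕ.* m)     ≡⟨ cong +_ eq ⟩
    + (b ℕ.* n)           ≡⟨ ℤₚ.pos-* b n ⟩
    + b * + n             ∎

record Bézout (x y : ℤ) : Set where
  field
    gcd s t  : ℤ
    gcd∣x    : gcd ∣ x
    gcd∣y    : gcd ∣ y
    identity : gcd ≡ s * x + t * y

bézout : ∀ x y → Bézout x y
bézout x y with ℕ-GCD.Bézout.lemma ∣ x ∣ ∣ y ∣
... | ℕ-GCD.Bézout.result d g identity = record
  { gcd      = + d
  ; s        = proj₁ (coefficients identity)
  ; t        = proj₁ (proj₂ (coefficients identity))
  ; gcd∣x    = ∣ᵤ⇒∣ (proj₁ (ℕ-GCD.GCD.commonDivisor g))
  ; gcd∣y    = ∣ᵤ⇒∣ (proj₂ (ℕ-GCD.GCD.commonDivisor g))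
  ; identity = proj₂ (proj₂ (coefficients identity))
  }
  where
  with-signs : ∀ P Q → P * + ∣ x ∣ - Q * + ∣ y ∣ ≡ (P * signum x) * x + (- (Q * signum y)) * y
  with-signs P Q = begin
    P * + ∣ x ∣ - Q * + ∣ y ∣
      ≡⟨ cong₂ (λ X Y → P * X - Q * Y) (abs-≡-signum-* x) (abs-≡-signum-* y) ⟩
    P * (signum x * x) - Q * (signum y * y)
      ≡⟨ lemma P Q (signum x) x (signum y) y ⟩
    (P * signum x) * x + (- (Q * signum y)) * y ∎
    where
    lemma : ∀ P Q σ x τ y → P * (σ * x) - Q * (τ * y) ≡ (P * σ) * x + (- (Q * τ)) * y
    lemma = solve-∀
  coefficients : ℕ-GCD.Bézout.Identity d ∣ x ∣ ∣ y ∣ → Σ ℤ λ s → Σ ℤ λ t → + d ≡ s * x + t * y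
  coefficients (ℕ-GCD.Bézout.+- a b eq) = + a * signum x , - (+ b * signum y) ,
     trans (cast-identity {a = b} {∣ y ∣} {a} {∣ x ∣} eq) (with-signs (+ a) (+ b))
  coefficients (ℕ-GCD.Bézout.-+ a b eq) = (- + a) * signum x , - ((- + b) * signum y) ,
     trans (cast-identity {a = a} {∣ x ∣} {b} {∣ y ∣} eq) (trans (flip (+ a) (+ b)) (with-signs (- + a) (- + b)))
    where
    flip : ∀ A B → B * + ∣ y ∣ - A * + ∣ x ∣ ≡ (- A) * + ∣ x ∣ - (- B) * + ∣ y ∣
    flip A B = lemma A B (+ ∣ x ∣) (+ ∣ y ∣)
      where
      lemma : ∀ A B X Y → B * Y - A * X ≡ (- A) * X - (- B) * Y
      lemma = solve-∀

record FamilyBézout {n} (y : Fin n → ℤ) : Set where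
  field
    gcd         : ℤ
    coeff quot  : Fin n → ℤ
    identity    : sum (λ j → coeff j * y j) ≡ gcd
    factor      : ∀ j → y j ≡ quot j * gcd

familyBézout : ∀ {n} (y : Fin n → ℤ) → FamilyBézout y
familyBézout {zero} y = record
  { gcd = + 0 ; coeff = λ () ; quot = λ () ; identity = refl ; factor = λ () }
familyBézout {suc n} y = record
  { gcd      = B.gcd
  ; coeff    = coeff
  ; quot     = quot
  ; identity = identity
  ; factor   = factor
  }
  where
  module T = FamilyBézout (familyBézout (y ∘ suc))
  module B = Bézout (bézout (y zero) T.gcd)
  coeff quot : Fin (suc n) → ℤ
  coeff zero    = B.s
  coeff (suc j) = B.t * T.coeff j
  quot zero    = _∣_.quotient B.gcd∣x
  quot (suc j) = T.quot j * _∣_.quotient B.gcd∣y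
  identity : B.s * y zero + sum (λ j → B.t * T.coeff j * y (suc j)) ≡ B.gcd
  identity = begin
    B.s * y zero + sum (λ j → B.t * T.coeff j * y (suc j))
      ≡⟨ cong (λ e → B.s * y zero + e) (sum-cong-≗ (λ j → ℤₚ.*-assoc B.t (T.coeff j) (y (suc j)))) ⟩
    B.s * y zero + sum (λ j → B.t * (T.coeff j * y (suc j)))
      ≡⟨ cong (λ e → B.s * y zero + e) (*-distribˡ-sum B.t (λ j → T.coeff j * y (suc j))) ⟨
    B.s * y zero + B.t * sum (λ j → T.coeff j * y (suc j))
      ≡⟨ cong (λ g → B.s * y zero + B.t * g) T.identity ⟩
    B.s * y zero + B.t * T.gcd
      ≡⟨ B.identity ⟨
    B.gcd ∎
  factor : ∀ j → y j ≡ quot j * B.gcd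
  factor zero    = _∣_.equality B.gcd∣x
  factor (suc j) = begin
    y (suc j)                                   ≡⟨ T.factor j ⟩
    T.quot j * T.gcd                            ≡⟨ cong (T.quot j *_) (_∣_.equality B.gcd∣y) ⟩
    T.quot j * (_∣_.quotient B.gcd∣y * B.gcd)   ≡⟨ ℤₚ.*-assoc (T.quot j) _ B.gcd ⟨
    quot (suc j) * B.gcd                        ∎

gcd∣det : ∀ {x y} (B : Bézout x y) w → Bézout.gcd B ∣ det (x , y) w
gcd∣det B (w₁ , w₂) = ∣m∣n⇒∣m-n (∣m⇒∣m*n w₂ (Bézout.gcd∣x B)) (∣m⇒∣m*n w₁ (Bézout.gcd∣y B))

primitive-if-gcd∣1 : ∀ {x y} (B : Bézout x y) → Bézout.gcd B ∣ + 1 → Primitive (x , y)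
primitive-if-gcd∣1 {x} {y} B (divides w 1≡w·gcd) = (- (w * t) , w * s) , (begin
  x * (w * s) - y * (- (w * t))   ≡⟨ lemma x y w s t ⟩
  w * (s * x + t * y)             ≡⟨ cong (w *_) identity ⟨
  w * gcd                         ≡⟨ 1≡w·gcd ⟨
  + 1                             ∎)
  where
  open Bézout B
  lemma : ∀ x y w s t → x * (w * s) - y * (- (w * t)) ≡ w * (s * x + t * y)
  lemma = solve-∀

-- Spanning families and lattice bases

sum-*-assocʳ : ∀ {n} (a b : Fin n → ℤ) k → sum (λ j → a j * (b j * k)) ≡ sum (λ j → a j * b j) * k
sum-*-assocʳ a b k = trans (sum-cong-≗ (λ j → sym (ℤₚ.*-assoc (a j) (b j) k)))
                           (sym (*-distribʳ-sum k (λ j → a j * b j)))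

sum-linear : ∀ {n} (c a b : Fin n → ℤ) P Q →
  sum (λ j → c j * (a j * P + b j * Q)) ≡ sum (λ j → c j * a j) * P + sum (λ j → c j * b j) * Q
sum-linear c a b P Q = begin
  sum (λ j → c j * (a j * P + b j * Q))
    ≡⟨ sum-cong-≗ (λ j → ℤₚ.*-distribˡ-+ (c j) (a j * P) (b j * Q)) ⟩
  sum (λ j → c j * (a j * P) + c j * (b j * Q))
    ≡⟨ ∑-distrib-+ (λ j → c j * (a j * P)) (λ j → c j * (b j * Q)) ⟩
  sum (λ j → c j * (a j * P)) + sum (λ j → c j * (b j * Q))
    ≡⟨ cong₂ _+_ (sum-*-assocʳ c a P) (sum-*-assocʳ c b Q) ⟩
  sum (λ j → c j * a j) * P + sum (λ j → c j * b j) * Q ∎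

sum-sub : ∀ {n} (a b v : Fin n → ℤ) s →
  sum (λ j → (a j - s * b j) * v j) ≡ sum (λ j → a j * v j) - s * sum (λ j → b j * v j)
sum-sub a b v s = begin
  sum (λ j → (a j - s * b j) * v j)
    ≡⟨ sum-cong-≗ (λ j → expand (a j) (b j) (v j) s) ⟩
  sum (λ j → a j * v j + (- s) * (b j * v j))
    ≡⟨ ∑-distrib-+ (λ j → a j * v j) (λ j → (- s) * (b j * v j)) ⟩
  sum (λ j → a j * v j) + sum (λ j → (- s) * (b j * v j))
    ≡⟨ cong (λ e → sum (λ j → a j * v j) + e) (*-distribˡ-sum (- s) (λ j → b j * v j)) ⟨
  sum (λ j → a j * v j) + (- s) * sum (λ j → b j * v j)
    ≡⟨ cong (λ e → sum (λ j → a j * v j) + e) (ℤₚ.neg-distribˡ-* s _) ⟨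
  sum (λ j → a j * v j) - s * sum (λ j → b j * v j) ∎
  where
  expand : ∀ a b v s → (a - s * b) * v ≡ a * v + (- s) * (b * v)
  expand = solve-∀

record Spanning {n} (u : Fin n → ℤ²) : Set where
  field
    coeff₁ coeff₂  : Fin n → ℤ
    combination-e₁ : combination coeff₁ u ≡ (+ 1 , + 0)
    combination-e₂ : combination coeff₂ u ≡ (+ 0 , + 1)

bilinear : ∀ {n} → (Fin n → ℤ) → (Fin n → ℤ) → (Fin n → Fin n → ℤ) → ℤ
bilinear a b D = sum (λ j → a j * sum (λ l → b l * D j l))

bilinear-cong : ∀ {n} (a b : Fin n → ℤ) {D E : Fin n → Fin n → ℤ} →
  (∀ j l → D j l ≡ E j l) → bilinear a b D ≡ bilinear a b E
bilinear-cong a b D≡E =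
  sum-cong-≗ (λ j → cong (a j *_) (sum-cong-≗ (λ l → cong (b l *_) (D≡E j l))))

*-distribˡ-bilinear : ∀ {n} k (a b : Fin n → ℤ) D →
  k * bilinear a b D ≡ bilinear a b (λ j l → k * D j l)
*-distribˡ-bilinear k a b D = begin
  k * bilinear a b D
    ≡⟨ *-distribˡ-sum k (λ j → a j * sum (λ l → b l * D j l)) ⟩
  sum (λ j → k * (a j * sum (λ l → b l * D j l)))
    ≡⟨ sum-cong-≗ (λ j → trans (left-commute k (a j) _)
                   (cong (a j *_) (*-distribˡ-sum k (λ l → b l * D j l)))) ⟩
  sum (λ j → a j * sum (λ l → k * (b l * D j l)))
    ≡⟨ sum-cong-≗ (λ j → cong (a j *_) (sum-cong-≗ (λ l → left-commute k (b l) (D j l)))) ⟩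
  bilinear a b (λ j l → k * D j l) ∎
  where
  left-commute : ∀ k a x → k * (a * x) ≡ a * (k * x)
  left-commute = solve-∀

bilinear-det-spanning : ∀ {n} {u : Fin n → ℤ²} (S : Spanning u) →
  bilinear (Spanning.coeff₁ S) (Spanning.coeff₂ S) (λ j l → det (u j) (u l)) ≡ + 1
bilinear-det-spanning {u = u} S = begin
  bilinear coeff₁ coeff₂ (λ j l → det (u j) (u l))
    ≡⟨ sum-cong-≗ (λ j → cong (coeff₁ j *_) (det-combinationʳ coeff₂ u (u j))) ⟨
  sum (λ j → coeff₁ j * det (u j) (combination coeff₂ u))
    ≡⟨ det-combinationˡ coeff₁ u (combination coeff₂ u) ⟨
  det (combination coeff₁ u) (combination coeff₂ u)
    ≡⟨ cong₂ det combination-e₁ combination-e₂ ⟩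
  + 1 ∎
  where open Spanning S

∣-bilinear : ∀ {n d} (a b : Fin n → ℤ) {D : Fin n → Fin n → ℤ} →
  (∀ j l → d ∣ D j l) → d ∣ bilinear a b D
∣-bilinear a b d∣D = ∣-sum (λ j → ∣n⇒∣m*n (a j) (∣-sum (λ l → ∣n⇒∣m*n (b l) (d∣D j l))))
  where
  ∣-sum : ∀ {n d} {f : Fin n → ℤ} → (∀ j → d ∣ f j) → d ∣ sum f
  ∣-sum {zero}  _     = divides (+ 0) refl
  ∣-sum {suc n} d∣f = ∣m∣n⇒∣m+n (d∣f zero) (∣-sum (d∣f ∘ suc))

spanning-det-divisor : ∀ {n} {u : Fin n → ℤ²} {d} → Spanning u →
  (∀ j l → d ∣ det (u j) (u l)) → d ∣ + 1
spanning-det-divisor S d∣det =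
  subst (_ ∣_) (bilinear-det-spanning S) (∣-bilinear (Spanning.coeff₁ S) (Spanning.coeff₂ S) d∣det)

-- The coefficient is read off by expanding 1 = det e₁ e₂ along a spanning family.
proportional-to-det : ∀ {n} {u : Fin n → ℤ²} → Spanning u → (f : Fin n → Fin n → ℤ) {a p : ℤ} →
  a ≢ + 0 → (∀ i j → p * det (u i) (u j) ≡ a * f i j) →
  ∃ λ k → ∀ i j → f i j ≡ k * det (u i) (u j)
proportional-to-det {u = u} S f {a} {p} a≢0 p·det≡a·f = k , f≡k·det
  where
  open Spanning S
  instance _ = ℤ.≢-nonZero a≢0
  k = bilinear coeff₁ coeff₂ f
  p≡a·k : p ≡ a * k
  p≡a·k = begin
    p                                                      ≡⟨ ℤₚ.*-identityʳ p ⟨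
    p * + 1                                                ≡⟨ cong (p *_) (bilinear-det-spanning S) ⟨
    p * bilinear coeff₁ coeff₂ (λ j l → det (u j) (u l))   ≡⟨ *-distribˡ-bilinear p coeff₁ coeff₂ _ ⟩
    bilinear coeff₁ coeff₂ (λ j l → p * det (u j) (u l))   ≡⟨ bilinear-cong coeff₁ coeff₂ p·det≡a·f ⟩
    bilinear coeff₁ coeff₂ (λ j l → a * f j l)             ≡⟨ *-distribˡ-bilinear a coeff₁ coeff₂ f ⟨
    a * k                                                  ∎
  f≡k·det : ∀ i j → f i j ≡ k * det (u i) (u j)
  f≡k·det i j = ℤₚ.*-cancelˡ-≡ a _ _ (begin
    a * f i j                  ≡⟨ p·det≡a·f i j ⟨
    p * det (u i) (u j)        ≡⟨ cong (_* det (u i) (u j)) p≡a·k ⟩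
    a * k * det (u i) (u j)    ≡⟨ ℤₚ.*-assoc a k _ ⟩
    a * (k * det (u i) (u j))  ∎)

spanning-primitive : ∀ {n} {u : Fin n → ℤ²} → Spanning u → ∀ i →
  (∀ {d} → (∀ l → d ∣ det (u i) (u l)) → ∀ j l → d ∣ det (u j) (u l)) → Primitive (u i)
spanning-primitive {u = u} S i spread =
  primitive-if-gcd∣1 B (spanning-det-divisor S (spread (λ l → gcd∣det B (u l))))
  where
  B = bézout (proj₁ (u i)) (proj₂ (u i))

record LatticeFactorisation {n} (G : Fin n → ℤ²) : Set where
  field
    index      : ℤ
    coords     : Fin n → ℤ²
    spanning   : Spanning coords
    det-factor : ∀ i j → det (G i) (G j) ≡ index * det (coords i) (coords j)

-- Hermite normal form: G j = (α j p + β j q , β j r), with r the gcd of the second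
-- coordinates y j and p the gcd of the x j − β j q.
factoriseLattice : ∀ {n} (G : Fin n → ℤ²) {i₀ i₁} → det (G i₀) (G i₁) ≢ + 0 →
  LatticeFactorisation G
factoriseLattice {n} G {i₀} {i₁} independent = record
  { index = p * r ; coords = u ; spanning = spanning ; det-factor = det-factor }
  where
  x y : Fin n → ℤ
  x j = proj₁ (G j)
  y j = proj₂ (G j)
  module Y = FamilyBézout (familyBézout y)
  r = Y.gcd
  μ = Y.coeff
  β = Y.quot
  q = sum (λ j → μ j * x j)
  module Z = FamilyBézout (familyBézout (λ j → x j - β j * q))
  p = Z.gcd
  ν = Z.coeff
  α = Z.quot
  u : Fin n → ℤ²
  u j = α j , β j

  x≡ : ∀ j → x j ≡ α j * p + β j * q
  x≡ j = trans (lemma (x j) (β j * q)) (cong (λ e → e + β j * q) (Z.factor j))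
    where
    lemma : ∀ a b → a ≡ (a - b) + b
    lemma = solve-∀

  det-factor : ∀ i j → det (G i) (G j) ≡ p * r * det (u i) (u j)
  det-factor i j = trans (cong₂ det (cong₂ _,_ (x≡ i) (Y.factor i)) (cong₂ _,_ (x≡ j) (Y.factor j)))
                         (lemma (α i) (β i) (α j) (β j) p q r)
    where
    lemma : ∀ a b a' b' p q r →
      (a * p + b * q) * (b' * r) - (b * r) * (a' * p + b' * q) ≡ p * r * (a * b' - b * a')
    lemma = solve-∀

  p·r≢0 : p * r ≢ + 0
  p·r≢0 p·r≡0 = independent (trans (det-factor i₀ i₁)
    (trans (cong (_* det (u i₀) (u i₁)) p·r≡0) (ℤₚ.*-zeroˡ (det (u i₀) (u i₁)))))

  instance
    p-nonZero : ℤ.NonZero p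
    p-nonZero = ℤ.≢-nonZero {p} (λ p≡0 → p·r≢0 (trans (cong (_* r) p≡0) (ℤₚ.*-zeroˡ r)))
    r-nonZero : ℤ.NonZero r
    r-nonZero = ℤ.≢-nonZero {r} (λ r≡0 → p·r≢0 (trans (cong (p *_) r≡0) (ℤₚ.*-zeroʳ p)))

  μβ≡1 : sum (λ j → μ j * β j) ≡ + 1
  μβ≡1 = ℤₚ.*-cancelʳ-≡ _ _ r (begin
    sum (λ j → μ j * β j) * r        ≡⟨ sum-*-assocʳ μ β r ⟨
    sum (λ j → μ j * (β j * r))      ≡⟨ sum-cong-≗ (λ j → cong (μ j *_) (Y.factor j)) ⟨
    sum (λ j → μ j * y j)            ≡⟨ Y.identity ⟩
    r                                ≡⟨ ℤₚ.*-identityˡ r ⟨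
    + 1 * r                          ∎)

  να≡1 : sum (λ j → ν j * α j) ≡ + 1
  να≡1 = ℤₚ.*-cancelʳ-≡ _ _ p (begin
    sum (λ j → ν j * α j) * p               ≡⟨ sum-*-assocʳ ν α p ⟨
    sum (λ j → ν j * (α j * p))             ≡⟨ sum-cong-≗ (λ j → cong (ν j *_) (Z.factor j)) ⟨
    sum (λ j → ν j * (x j - β j * q))       ≡⟨ Z.identity ⟩
    p                                       ≡⟨ ℤₚ.*-identityˡ p ⟨
    + 1 * p                                 ∎)

  μα≡0 : sum (λ j → μ j * α j) ≡ + 0
  μα≡0 = ℤₚ.*-cancelʳ-≡ _ _ p (cancel-q {sum (λ j → μ j * α j)} (begin
    q                                                             ≡⟨ sum-cong-≗ (λ j → cong (μ j *_) (x≡ j)) ⟩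
    sum (λ j → μ j * (α j * p + β j * q))                         ≡⟨ sum-linear μ α β p q ⟩
    sum (λ j → μ j * α j) * p + sum (λ j → μ j * β j) * q         ≡⟨ cong (λ e → sum (λ j → μ j * α j) * p + e * q) μβ≡1 ⟩
    sum (λ j → μ j * α j) * p + + 1 * q                           ∎))
    where
    cancel-q : ∀ {A} → q ≡ A * p + + 1 * q → A * p ≡ + 0 * p
    cancel-q {A} e = trans (lemma (A * p) q)
      (trans (cong (_- q) (sym e)) (trans (ℤₚ.+-inverseʳ q) (sym (ℤₚ.*-zeroˡ p))))
      where
      lemma : ∀ X q → X ≡ X + + 1 * q - q
      lemma = solve-∀

  spanning : Spanning u
  spanning = record
    { coeff₁ = λ j → ν j - s * μ j
    ; coeff₂ = μ
    ; combination-e₁ = cong₂ _,_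
        (trans (sum-sub ν μ α s) (trans (cong₂ (λ A B → A - s * B) να≡1 μα≡0) (first s)))
        (trans (sum-sub ν μ β s) (trans (cong (λ B → s - s * B) μβ≡1) (second s)))
    ; combination-e₂ = cong₂ _,_ μα≡0 μβ≡1
    }
    where
    s = sum (λ j → ν j * β j)
    first : ∀ s → + 1 - s * + 0 ≡ + 1
    first = solve-∀
    second : ∀ s → s - s * + 1 ≡ + 0
    second = solve-∀

-- Friezes realised by plane vectors

record Realisation {n} (f : Fin n → Fin n → ℤ) : Set where
  field
    k        : ℕ
    vectors  : Fin n → ℤ²
    spanning : Spanning vectors
    realises : ∀ i j → f i j ≡ +[1+ k ] * det (vectors i) (vectors j)

realisation-of-scale : ∀ {n} {u : Fin n → ℤ²} → Spanning u → (f : Fin n → Fin n → ℤ) {K : ℤ} →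
  K ≢ + 0 → (∀ i j → f i j ≡ K * det (u i) (u j)) → Realisation f
realisation-of-scale S f {+ zero} K≢0 _ = ⊥-elim (K≢0 refl)
realisation-of-scale S f {+[1+ k ]} _ f≡K·det = record
  { k = k ; vectors = _ ; spanning = S ; realises = f≡K·det }
-- A negative scale is absorbed by swapping the coordinates, which negates every determinant.
realisation-of-scale {u = u} S f { -[1+ k ]} _ f≡K·det = record
  { k        = k
  ; vectors  = swap ∘ u
  ; spanning = record
    { coeff₁ = coeff₂ ; coeff₂ = coeff₁
    ; combination-e₁ = cong swap combination-e₂ ; combination-e₂ = cong swap combination-e₁ }
  ; realises = λ i j → begin
      f i j                                          ≡⟨ f≡K·det i j ⟩
      -[1+ k ] * det (u i) (u j)                     ≡⟨ lemma +[1+ k ] (det (u i) (u j)) ⟩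
      +[1+ k ] * - det (u i) (u j)                   ≡⟨ cong (+[1+ k ] *_) (det-swap (u i) (u j)) ⟨
      +[1+ k ] * det (swap (u i)) (swap (u j))       ∎
  }
  where
  open Spanning S
  lemma : ∀ K D → (- K) * D ≡ K * (- D)
  lemma = solve-∀

module _ {n} (c : Labelling n) where

  signed : Fin n → Fin n → ℤ
  signed i j with Finₚ.<-cmp i j
  ... | tri< _ _ _ = + c i j
  ... | tri≈ _ _ _ = + 0
  ... | tri> _ _ _ = - + c j i

  signed-< : ∀ {i j} → i Fin.< j → signed i j ≡ + c i j
  signed-< {i} {j} i<j with Finₚ.<-cmp i j
  ... | tri< _ _ _    = refl
  ... | tri≈ i≮j _ _  = ⊥-elim (i≮j i<j)
  ... | tri> i≮j _ _  = ⊥-elim (i≮j i<j)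

  signed-> : ∀ {i j} → j Fin.< i → signed i j ≡ - + c j i
  signed-> {i} {j} j<i with Finₚ.<-cmp i j
  ... | tri< _ _ j≮i  = ⊥-elim (j≮i j<i)
  ... | tri≈ _ _ j≮i  = ⊥-elim (j≮i j<i)
  ... | tri> _ _ _    = refl

  signed-self : ∀ i → signed i i ≡ + 0
  signed-self i with Finₚ.<-cmp i i
  ... | tri< i<i _ _ = ⊥-elim (Finₚ.<-irrefl refl i<i)
  ... | tri≈ _ _ _   = refl
  ... | tri> _ _ i<i = ⊥-elim (Finₚ.<-irrefl refl i<i)

  signed-antisym : ∀ i j → signed j i ≡ - signed i j
  signed-antisym i j with Finₚ.<-cmp i j
  ... | tri< i<j _ _  = signed-> i<j
  ... | tri≈ _ refl _ = signed-self i
  ... | tri> _ _ j<i  = trans (signed-< j<i) (sym (ℤₚ.neg-involutive _))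

wlog-< : ∀ {n} (P : Fin n → Fin n → Set) → (∀ {i j} → i ≢ j → P i j → P j i) →
  (∀ {i j} → i Fin.< j → P i j) → ∀ {i j} → i ≢ j → P i j
wlog-< P flip base {i} {j} i≢j with Finₚ.<-cmp i j
... | tri< i<j _ _ = base i<j
... | tri≈ _ i≡j _ = ⊥-elim (i≢j i≡j)
... | tri> _ _ j<i = flip (i≢j ∘ sym) (base j<i)

module _ {n} {c : Labelling n} (fr : IsFrieze n c) where
  open IsFrieze fr

  ∣signed∣ : ∀ {i j} → i ≢ j → ∣ signed c i j ∣ ≡ c i j
  ∣signed∣ = wlog-< (λ i j → ∣ signed c i j ∣ ≡ c i j) flip (λ i<j → cong ∣_∣ (signed-< c i<j))
    where
    flip : ∀ {i j} → i ≢ j → ∣ signed c i j ∣ ≡ c i j → ∣ signed c j i ∣ ≡ c j i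
    flip {i} {j} i≢j ∣sᵢⱼ∣≡cᵢⱼ = begin
      ∣ signed c j i ∣     ≡⟨ cong ∣_∣ (signed-antisym c i j) ⟩
      ∣ - signed c i j ∣   ≡⟨ ℤₚ.∣-i∣≡∣i∣ (signed c i j) ⟩
      ∣ signed c i j ∣     ≡⟨ ∣sᵢⱼ∣≡cᵢⱼ ⟩
      c i j                ≡⟨ symmetric i j i≢j ⟩
      c j i                ∎

module _ {n} {c : Labelling (suc (suc n))} (fr : IsFrieze (suc (suc n)) c) where
  open IsFrieze fr

  private
    a : ℤ
    a = + c zero (suc zero)
    0<1 : zero {suc n} Fin.< suc (zero {n})
    0<1 = s≤s z≤n

  column : Fin (suc (suc n)) → ℤ²
  column j = signed c zero j , signed c (suc zero) j

  private
    column-0 : column zero ≡ (+ 0 , - a)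
    column-0 = cong₂ _,_ (signed-self c zero) (signed-> c 0<1)
    column-1 : column (suc zero) ≡ (a , + 0)
    column-1 = cong₂ _,_ (signed-< c 0<1) (signed-self c (suc zero))
    column-2+ : ∀ j → column (suc (suc j)) ≡ (+ c zero (suc (suc j)) , + c (suc zero) (suc (suc j)))
    column-2+ j = cong₂ _,_ (signed-< c (s≤s z≤n)) (signed-< c (s≤s (s≤s z≤n)))

  -- For i, j ≥ 2 this is the Ptolemy relation on the quadrilateral 0 < 1 < i < j.
  det-column-< : ∀ {i j} → i Fin.< j → det (column i) (column j) ≡ a * signed c i j
  det-column-< {zero} {suc zero} i<j =
    trans (cong₂ det column-0 column-1) (trans (lemma a) (cong (a *_) (sym (signed-< c i<j))))
    where
    lemma : ∀ a → + 0 * + 0 - (- a) * a ≡ a * a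
    lemma = solve-∀
  det-column-< {zero} {suc (suc j)} i<j =
    trans (cong₂ det column-0 (column-2+ j))
          (trans (lemma a (+ c zero (suc (suc j))) (+ c (suc zero) (suc (suc j))))
                 (cong (a *_) (sym (signed-< c i<j))))
    where
    lemma : ∀ a x y → + 0 * y - (- a) * x ≡ a * x
    lemma = solve-∀
  det-column-< {suc zero} {suc (suc j)} i<j =
    trans (cong₂ det column-1 (column-2+ j))
          (trans (lemma a (+ c zero (suc (suc j))) (+ c (suc zero) (suc (suc j))))
                 (cong (a *_) (sym (signed-< c i<j))))
    where
    lemma : ∀ a x y → a * y - + 0 * x ≡ a * y
    lemma = solve-∀
  det-column-< {suc (suc i)} {suc (suc j)} i<j =
    trans (cong₂ det (column-2+ i) (column-2+ j))
          (trans (rearrange (+ c zero k) (+ c (suc zero) l) (+ c zero l) (+ c (suc zero) k) (+ c k l) lifted)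
                 (cong (a *_) (sym (signed-< c i<j))))
    where
    k l : Fin (suc (suc n))
    k = suc (suc i)
    l = suc (suc j)
    lifted : + c zero k * + c (suc zero) l ≡ + c zero l * + c (suc zero) k + a * + c k l
    lifted = trans (sym (ℤₚ.pos-* (c zero k) (c (suc zero) l)))
      (trans (cong +_ (ptolemy zero (suc zero) k l 0<1 (s≤s (s≤s z≤n)) i<j))
             (pos-*+* (c zero l) (c (suc zero) k) (c zero (suc zero)) (c k l)))
    rearrange : ∀ w x y z e → w * x ≡ y * z + a * e → w * x - z * y ≡ a * e
    rearrange w x y z e eq = trans (cong (_- z * y) eq) (lemma y z a e)
      where
      lemma : ∀ y z a e → y * z + a * e - z * y ≡ a * e
      lemma = solve-∀
  det-column-< {zero} {zero} ()
  det-column-< {suc zero} {zero} ()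
  det-column-< {suc zero} {suc zero} (s≤s ())
  det-column-< {suc (suc i)} {zero} ()
  det-column-< {suc (suc i)} {suc zero} (s≤s ())

  det-column : ∀ i j → det (column i) (column j) ≡ a * signed c i j
  det-column i j with i Fin.≟ j
  ... | yes refl = trans (det-self (column i)) (sym (trans (cong (a *_) (signed-self c i)) (ℤₚ.*-zeroʳ a)))
  ... | no i≢j   = wlog-< (λ i j → det (column i) (column j) ≡ a * signed c i j) flip det-column-< i≢j
    where
    flip : ∀ {i j} → i ≢ j → det (column i) (column j) ≡ a * signed c i j →
           det (column j) (column i) ≡ a * signed c j i
    flip {i} {j} _ eq = begin
      det (column j) (column i)   ≡⟨ det-antisym (column i) (column j) ⟩
      - det (column i) (column j) ≡⟨ cong -_ eq ⟩
      - (a * signed c i j)        ≡⟨ ℤₚ.neg-distribʳ-* a (signed c i j) ⟩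
      a * - signed c i j          ≡⟨ cong (a *_) (signed-antisym c i j) ⟨
      a * signed c j i            ∎

  frieze-realisation : Realisation (signed c)
  frieze-realisation = realisation-of-scale L.spanning (signed c) K≢0 signed≡K·det
    where
    a≢0 : a ≢ + 0
    a≢0 a≡0 = ℕₚ.<-irrefl refl (subst (0 ℕ.<_) (ℤₚ.+-injective a≡0) (positive zero (suc zero) (λ ())))
    independent : det (column zero) (column (suc zero)) ≢ + 0
    independent det≡0 with ℤₚ.i*j≡0⇒i≡0∨j≡0 a (trans (cong (a *_) (sym (signed-< c 0<1)))
                                                   (trans (sym (det-column zero (suc zero))) det≡0))
    ... | inj₁ a≡0 = a≢0 a≡0
    ... | inj₂ a≡0 = a≢0 a≡0
    module L = LatticeFactorisation (factoriseLattice column {zero} {suc zero} independent)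
    proportional = proportional-to-det L.spanning (signed c) {p = L.index} a≢0
      (λ i j → trans (sym (L.det-factor i j)) (det-column i j))
    K = proj₁ proportional
    signed≡K·det = proj₂ proportional
    K≢0 : K ≢ + 0
    K≢0 K≡0 = a≢0 (begin
      a                                                 ≡⟨ signed-< c 0<1 ⟨
      signed c zero (suc zero)                          ≡⟨ signed≡K·det zero (suc zero) ⟩
      K * det (L.coords zero) (L.coords (suc zero))     ≡⟨ cong (_* det (L.coords zero) (L.coords (suc zero))) K≡0 ⟩
      + 0 * det (L.coords zero) (L.coords (suc zero))   ≡⟨ ℤₚ.*-zeroˡ (det (L.coords zero) (L.coords (suc zero))) ⟩
      + 0                                               ∎)

module _ {n} {c : Labelling n} (fr : IsFrieze n c) (R : Realisation (signed c)) where
  open IsFrieze fr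
  open Realisation R

  realisation-det-positive : ∀ {i j} → i Fin.< j → PosDet (vectors i) (vectors j)
  realisation-det-positive {i} {j} i<j
    with c i j | positive i j (λ { refl → Finₚ.<-irrefl refl i<j }) | signed-< c i<j
  ... | suc t | _ | sᵢⱼ≡ = pos-cancelˡ (k , refl) (t , trans (sym (realises i j)) sᵢⱼ≡)

  module _ (tg : TriangleGcdCondition n c) where

    gcd-∣-opposite : ∀ {i j l} → i ≢ j → i ≢ l → j ≢ l → ℕ-GCD.gcd (c i j) (c i l) ∣ℕ c j l
    gcd-∣-opposite {i} i≢j i≢l j≢l =
      wlog-< (λ j l → i ≢ j → i ≢ l → ℕ-GCD.gcd (c i j) (c i l) ∣ℕ c j l) flip base j≢l i≢j i≢l
      where
      flip : ∀ {j l} → j ≢ l → (i ≢ j → i ≢ l → ℕ-GCD.gcd (c i j) (c i l) ∣ℕ c j l) →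
             i ≢ l → i ≢ j → ℕ-GCD.gcd (c i l) (c i j) ∣ℕ c l j
      flip {j} {l} j≢l gcd∣ i≢l i≢j =
        subst₂ _∣ℕ_ (ℕ-GCD.gcd-comm (c i j) (c i l)) (symmetric j l j≢l) (gcd∣ i≢j i≢l)
      triangle : ∀ {x y z} → x Fin.< y → y Fin.< z →
        ℕ-GCD.gcd (c x y) (c x z) ∣ℕ c y z ×
        ℕ-GCD.gcd (c x y) (c y z) ∣ℕ c x z ×
        ℕ-GCD.gcd (c x z) (c y z) ∣ℕ c x y
      triangle {x} {y} {z} x<y y<z =
        subst (_∣ℕ c y z) (trans gcd₁≡gcd₂ gcd₂≡gcd₃) (ℕ-GCD.gcd[m,n]∣n (c x y) (c y z)) ,
        subst (_∣ℕ c x z) (sym gcd₁≡gcd₂) (ℕ-GCD.gcd[m,n]∣n (c y z) (c x z)) ,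
        subst (_∣ℕ c x y) (trans gcd₁≡gcd₂ (ℕ-GCD.gcd-comm (c y z) (c x z))) (ℕ-GCD.gcd[m,n]∣m (c x y) (c y z))
        where
        gcd₁≡gcd₂ = proj₁ (tg x y z x<y y<z)
        gcd₂≡gcd₃ = proj₂ (tg x y z x<y y<z)
      base : ∀ {j l} → j Fin.< l → i ≢ j → i ≢ l → ℕ-GCD.gcd (c i j) (c i l) ∣ℕ c j l
      base {j} {l} j<l i≢j i≢l with Finₚ.<-cmp i j | Finₚ.<-cmp i l
      ... | tri< i<j _ _ | _            = proj₁ (triangle i<j j<l)
      ... | tri≈ _ i≡j _ | _            = ⊥-elim (i≢j i≡j)
      ... | tri> _ _ j<i | tri< i<l _ _ =
        subst (λ g → ℕ-GCD.gcd g (c i l) ∣ℕ c j l) (symmetric j i (i≢j ∘ sym))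
              (proj₁ (proj₂ (triangle j<i i<l)))
      ... | tri> _ _ _   | tri≈ _ i≡l _ = ⊥-elim (i≢l i≡l)
      ... | tri> _ _ j<i | tri> _ _ l<i =
        subst₂ (λ g h → ℕ-GCD.gcd g h ∣ℕ c j l) (symmetric j i (i≢j ∘ sym)) (symmetric l i (i≢l ∘ sym))
               (proj₂ (proj₂ (triangle j<l l<i)))

    -- With K the scale, K d divides signed c i j and signed c i l, hence by the gcd condition
    -- on the triangle i j l also signed c j l = K · det (u j) (u l).
    divisor-spreads : ∀ {d} i → (∀ l → d ∣ det (vectors i) (vectors l)) →
      ∀ j l → d ∣ det (vectors j) (vectors l)
    divisor-spreads {d} i d∣ j l with i Fin.≟ j | i Fin.≟ l | j Fin.≟ l
    ... | yes refl | _        | _        = d∣ l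
    ... | no _     | yes refl | _        =
      subst (d ∣_) (sym (det-antisym (vectors i) (vectors j))) (∣m⇒∣-m (d∣ j))
    ... | no _     | no _     | yes refl = subst (d ∣_) (sym (det-self (vectors j))) (divides (+ 0) refl)
    ... | no i≢j   | no i≢l   | no j≢l   = *-cancelˡ-∣ +[1+ k ] K·d∣K·det
      where
      K·d∣c : ∀ {l} → i ≢ l → ∣ +[1+ k ] * d ∣ ∣ℕ c i l
      K·d∣c {l} i≢l = subst (_ ∣ℕ_) (∣signed∣ fr i≢l)
        (∣⇒∣ᵤ (subst (_ ∣_) (sym (realises i l)) (*-monoʳ-∣ +[1+ k ] (d∣ l))))
      K·d∣K·det : +[1+ k ] * d ∣ +[1+ k ] * det (vectors j) (vectors l)
      K·d∣K·det = subst (_ ∣_) (realises j l) (∣ᵤ⇒∣ (subst (_ ∣ℕ_) (sym (∣signed∣ fr j≢l))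
        (∣ℕ-trans (ℕ-GCD.gcd-greatest (K·d∣c i≢j) (K·d∣c i≢l)) (gcd-∣-opposite i≢j i≢l j≢l))))

    realisation-primitive : ∀ i → Primitive (vectors i)
    realisation-primitive i = spanning-primitive spanning i (divisor-spreads i)

-- Farey chains

record Chain (u w : ℤ²) : Set where
  field
    points     : List ℤ²
    unimodular : Linked Unimodular (u ∷ points ++ [ w ])
    between    : All (λ x → PosDet u x × PosDet x w) points

-- The Farey/Euclid step: with det u z = 1, the vector v = z + t u with t = -(det z w div
-- det u w) satisfies det u v = 1 and det v w = det z w mod det u w, which is non-zero
-- because w is primitive and det u w ≥ 2.
chain : ∀ {u w} → Primitive u → Primitive w → PosDet u w → Chain u w
chain prim-u prim-w (A , det≡) = <-rec Motive step A prim-u prim-w det≡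
  where
  Motive : ℕ → Set
  Motive A = ∀ {u w} → Primitive u → Primitive w → det u w ≡ +[1+ A ] → Chain u w

  step : ∀ A → (∀ {B} → B ℕ.< A → Motive B) → Motive A
  step zero _ _ _ det≡1 = record { points = [] ; unimodular = det≡1 ∷ [-] ; between = [] }
  step (suc A) rec {u} {w} (z , det-uz≡1) (z′ , det-wz′≡1) det-uw≡M = record
    { points     = v ∷ Chain.points C
    ; unimodular = det-uv≡1 ∷ Chain.unimodular C
    ; between    = ((0 , det-uv≡1) , (B , det-vw≡))
                   ∷ All.map (λ { (pos-vx , pos-xw) → inner pos-vx pos-xw , pos-xw }) (Chain.between C)
    }
    where
    M : ℕ
    M = suc (suc A)
    t : ℤ
    t = - (det z w /ℕ M)
    v : ℤ²
    v = proj₁ z + t * proj₁ u , proj₂ z + t * proj₂ u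

    det-uv≡1 : det u v ≡ + 1
    det-uv≡1 = trans (lemma (proj₁ u) (proj₂ u) (proj₁ z) (proj₂ z) t) det-uz≡1
      where
      lemma : ∀ u₁ u₂ z₁ z₂ t → u₁ * (z₂ + t * u₂) - u₂ * (z₁ + t * u₁) ≡ u₁ * z₂ - u₂ * z₁
      lemma = solve-∀

    det-vw≡residue : det v w ≡ + (det z w %ℕ M)
    det-vw≡residue = begin
      det v w                                  ≡⟨ shear (proj₁ u) (proj₂ u) (proj₁ z) (proj₂ z) t (proj₁ w) (proj₂ w) ⟩
      det z w + t * det u w                    ≡⟨ cong (λ e → det z w + t * e) det-uw≡M ⟩
      det z w + t * + M                        ≡⟨ cong (λ e → e + t * + M) (a≡a%ℕn+[a/ℕn]*n (det z w) M) ⟩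
      + (det z w %ℕ M) + (det z w /ℕ M) * + M + t * + M ≡⟨ lemma (+ (det z w %ℕ M)) (det z w /ℕ M) (+ M) ⟩
      + (det z w %ℕ M)                         ∎
      where
      shear : ∀ u₁ u₂ z₁ z₂ t w₁ w₂ →
        (z₁ + t * u₁) * w₂ - (z₂ + t * u₂) * w₁ ≡ (z₁ * w₂ - z₂ * w₁) + t * (u₁ * w₂ - u₂ * w₁)
      shear = solve-∀
      lemma : ∀ r q m → r + q * m + (- q) * m ≡ r
      lemma = solve-∀

    -- det u v · det w z′ = det u z′ · det w v + det u w · det v z′ forces M ∣ 1 if det v w = 0.
    residue≢0 : det z w %ℕ M ≢ 0
    residue≢0 r≡0 = ℕₚ.<-irrefl refl (ℕₚ.≤-trans (s≤s (s≤s z≤n)) (ℕₚ.≤-reflexive M≡1))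
      where
      det-vw≡0 : det v w ≡ + 0
      det-vw≡0 = trans det-vw≡residue (cong +_ r≡0)
      X = det v z′
      1≡M·X : + 1 ≡ + M * X
      1≡M·X = begin
        + 1                                        ≡⟨ cong₂ _*_ det-uv≡1 det-wz′≡1 ⟨
        det u v * det w z′                         ≡⟨ plücker u w v z′ ⟩
        det u z′ * det w v + det u w * X           ≡⟨ cong₂ (λ p q → det u z′ * p + q * X)
                                                        (trans (det-antisym v w) (cong -_ det-vw≡0)) det-uw≡M ⟩
        det u z′ * (- + 0) + + M * X               ≡⟨ lemma (det u z′) (+ M * X) ⟩
        + M * X                                    ∎
        where
        lemma : ∀ a b → a * (- + 0) + b ≡ b
        lemma = solve-∀
      M≡1 : M ≡ 1
      M≡1 = ℕₚ.m*n≡1⇒m≡1 M ∣ X ∣ (sym (trans (cong ∣_∣ 1≡M·X) (ℤₚ.abs-* (+ M) X)))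

    predecessor : ∀ r → r ≢ 0 → ∃ λ B → r ≡ suc B
    predecessor zero    r≢0 = ⊥-elim (r≢0 refl)
    predecessor (suc B) _   = B , refl

    B = proj₁ (predecessor _ residue≢0)
    det-vw≡ : det v w ≡ +[1+ B ]
    det-vw≡ = trans det-vw≡residue (cong +_ (proj₂ (predecessor _ residue≢0)))
    B<A : B ℕ.< suc A
    B<A = ℕ.s≤s⁻¹ (subst (ℕ._< M) (proj₂ (predecessor _ residue≢0)) (n%ℕd<d (det z w) M))

    C : Chain v w
    C = rec B<A (negate u , trans (det-negateʳ v u) det-uv≡1) (z′ , det-wz′≡1) det-vw≡

    inner : ∀ {x} → PosDet v x → PosDet x w → PosDet u x
    inner {x} = between-positive u x v w (B , det-vw≡) (pos⇒nonNeg (0 , det-uv≡1))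
                             (pos⇒nonNeg (suc A , det-uw≡M)) (inj₁ (0 , det-uv≡1))

-- Closed unimodular polygons

-- Indices past the end give (0 , 0); only indices in range are ever used.
_‼_ : List ℤ² → ℕ → ℤ²
[]       ‼ _     = + 0 , + 0
(x ∷ xs) ‼ zero  = x
(x ∷ xs) ‼ suc k = xs ‼ k

‼-++ˡ : ∀ xs ys {k} → k ℕ.< length xs → (xs ++ ys) ‼ k ≡ xs ‼ k
‼-++ˡ (x ∷ xs) ys {zero}  _       = refl
‼-++ˡ (x ∷ xs) ys {suc k} (s≤s k<) = ‼-++ˡ xs ys k<

‼-++ʳ : ∀ xs ys k → (xs ++ ys) ‼ (length xs ℕ.+ k) ≡ ys ‼ k
‼-++ʳ []       ys k = refl
‼-++ʳ (x ∷ xs) ys k = ‼-++ʳ xs ys k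

linked-‼ : ∀ {R : ℤ² → ℤ² → Set} xs {k} → Linked R xs → suc k ℕ.< length xs → R (xs ‼ k) (xs ‼ suc k)
linked-‼ (x ∷ y ∷ xs) {zero}  (Rxy ∷ _)   _        = Rxy
linked-‼ (x ∷ y ∷ xs) {suc k} (_ ∷ Rxs)   (s≤s k<) = linked-‼ (y ∷ xs) Rxs k<
linked-‼ (x ∷ [])     {k}     [-]         (s≤s ())

allPairs-‼ : ∀ {R : ℤ² → ℤ² → Set} xs {s t} → AllPairs R xs → s ℕ.< t → t ℕ.< length xs →
  R (xs ‼ s) (xs ‼ t)
allPairs-‼ {R} (x ∷ xs) {zero}  {suc t} (Rx ∷ _)   _         (s≤s t<) = all-‼ xs Rx t<
  where
  all-‼ : ∀ ys {t} → All (R x) ys → t ℕ.< length ys → R x (ys ‼ t)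
  all-‼ (y ∷ ys) {zero}  (Ry ∷ _)   _        = Ry
  all-‼ (y ∷ ys) {suc t} (_ ∷ Rys)  (s≤s t<) = all-‼ ys Rys t<
allPairs-‼ (x ∷ xs) {suc s} {suc t} (_ ∷ Rxs) (s≤s s<t) (s≤s t<) = allPairs-‼ xs Rxs s<t t<

linked-prefix : ∀ {R : ℤ² → ℤ² → Set} xs {ys} → Linked R (xs ++ ys) → Linked R xs
linked-prefix []           _         = []
linked-prefix (x ∷ [])     _         = [-]
linked-prefix (x ∷ y ∷ xs) (Rxy ∷ l) = Rxy ∷ linked-prefix (y ∷ xs) l

linked-join : ∀ {R : ℤ² → ℤ² → Set} xs {y ys} → Linked R (xs ++ [ y ]) → Linked R (y ∷ ys) →
  Linked R (xs ++ y ∷ ys)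
linked-join []           _           l = l
linked-join (x ∷ [])     (Rxy ∷ [-]) l = Rxy ∷ l
linked-join (x ∷ x′ ∷ xs) (Rxx′ ∷ l₁) l = Rxx′ ∷ linked-join (x′ ∷ xs) l₁ l

convex-if-unimodular : ∀ {o ys} → All (PosDet o) ys → Linked Unimodular ys → AllPairs PosDet ys
convex-if-unimodular {o} pos-o linked =
  AllPairs.map (proj₂ ∘ proj₂) (Linked⇒AllPairs seen-trans (seen pos-o linked))
  where
  Seen : ℤ² → ℤ² → Set
  Seen x y = PosDet o x × PosDet o y × PosDet x y
  seen-trans : ∀ {x y z} → Seen x y → Seen y z → Seen x z
  seen-trans {x} {y} {z} (pos-ox , pos-oy , pos-xy) (_ , pos-oz , pos-yz) =
    pos-ox , pos-oz , posDet-trans o x y z pos-ox pos-oy pos-oz pos-xy pos-yz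
  seen : ∀ {ys} → All (PosDet o) ys → Linked Unimodular ys → Linked Seen ys
  seen []                     []          = []
  seen (_ ∷ [])               [-]         = [-]
  seen (pos-ox ∷ pos-oy ∷ ps) (det≡1 ∷ l) = (pos-ox , pos-oy , (0 , det≡1)) ∷ seen (pos-oy ∷ ps) l

record Refinement {n} (u : Fin (suc n) → ℤ²) (w : ℤ²) : Set where
  field
    rest          : List ℤ²
    unimodular    : Linked Unimodular (u zero ∷ rest ++ [ w ])
    position      : Fin (suc n) → ℕ
    position-<    : ∀ i → position i ℕ.< suc (length rest)
    position-mono : ∀ {i j} → i Fin.< j → position i ℕ.< position j
    at-position   : ∀ i → (u zero ∷ rest) ‼ position i ≡ u i
    positive      : ∀ {o} → (∀ i → PosDet o (u i)) → NonNeg (det o w) → All (PosDet o) rest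
    positive₀     : NonNeg (det (u zero) w) → All (PosDet (u zero)) rest

refine : ∀ {w} → Primitive w → ∀ n (u : Fin (suc n) → ℤ²) → (∀ i → Primitive (u i)) →
  (∀ {i j} → i Fin.< j → PosDet (u i) (u j)) → PosDet (u (Fin.fromℕ n)) w → Refinement u w
refine {w} prim-w zero u prim _ pos-w = record
  { rest          = C.points
  ; unimodular    = C.unimodular
  ; position      = λ _ → 0
  ; position-<    = λ _ → s≤s z≤n
  ; position-mono = λ { {zero} {zero} () }
  ; at-position   = λ { zero → refl }
  ; positive      = λ {o} pos-o nn-ow → All.map (λ {x} (pos-ux , pos-xw) →
                      between-positive o x (u zero) w pos-w (pos⇒nonNeg (pos-o zero)) nn-ow (inj₁ (pos-o zero)) pos-ux pos-xw)
                      C.between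
  ; positive₀     = λ _ → All.map proj₁ C.between
  }
  where
  module C = Chain (chain {u zero} {w} (prim zero) prim-w pos-w)
refine {w} prim-w (suc n) u prim ascending pos-w = record
  { rest          = C.points ++ u (suc zero) ∷ R.rest
  ; unimodular    = subst (λ l → Linked Unimodular (u zero ∷ l))
                          (sym (Listₚ.++-assoc C.points (u (suc zero) ∷ R.rest) [ w ]))
                          (linked-join (u zero ∷ C.points) C.unimodular R.unimodular)
  ; position      = position
  ; position-<    = position-<
  ; position-mono = position-mono
  ; at-position   = at-position
  ; positive      = λ {o} pos-o nn-ow → Allₚ.++⁺
      (All.map (λ {x} (pos-ux , pos-xu₁) → between-positive o x (u zero) (u (suc zero)) (ascending 0<1) (pos⇒nonNeg (pos-o zero))
                      (pos⇒nonNeg (pos-o (suc zero))) (inj₁ (pos-o zero)) pos-ux pos-xu₁) C.between)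
      (pos-o (suc zero) ∷ R.positive {o} (pos-o ∘ suc) nn-ow)
  ; positive₀     = λ nn-w → Allₚ.++⁺ (All.map proj₁ C.between)
      (ascending 0<1 ∷ R.positive {u zero} (λ i → ascending {zero} {suc i} (s≤s z≤n)) nn-w)
  }
  where
  0<1 : zero {suc n} Fin.< suc (zero {n})
  0<1 = s≤s z≤n
  module C = Chain (chain {u zero} {u (suc zero)} (prim zero) (prim (suc zero)) (ascending 0<1))
  module R = Refinement (refine prim-w n (u ∘ suc) (prim ∘ suc) (ascending ∘ s≤s) pos-w)
  position : Fin (suc (suc n)) → ℕ
  position zero    = 0
  position (suc i) = suc (length C.points ℕ.+ R.position i)
  position-< : ∀ i → position i ℕ.< suc (length (C.points ++ u (suc zero) ∷ R.rest))
  position-< zero    = s≤s z≤n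
  position-< (suc i) = s≤s (subst (length C.points ℕ.+ R.position i ℕ.<_)
    (sym (Listₚ.length-++ C.points)) (ℕₚ.+-monoʳ-< (length C.points) (R.position-< i)))
  position-mono : ∀ {i j} → i Fin.< j → position i ℕ.< position j
  position-mono {zero}  {suc j} _         = s≤s z≤n
  position-mono {suc i} {suc j} (s≤s i<j) = s≤s (ℕₚ.+-monoʳ-< (length C.points) (R.position-mono i<j))
  at-position : ∀ i → (u zero ∷ C.points ++ u (suc zero) ∷ R.rest) ‼ position i ≡ u i
  at-position zero    = refl
  at-position (suc i) = trans (‼-++ʳ C.points (u (suc zero) ∷ R.rest) (R.position i)) (R.at-position i)

record Completion {N} (u : Fin N → ℤ²) : Set where
  field
    polygon      : List ℤ²
    closed       : Linked Unimodular (polygon ++ [ negate (polygon ‼ 0) ])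
    convex       : AllPairs PosDet polygon
    embed        : Fin N → Fin (length polygon)
    embed-mono   : ∀ {i j} → i Fin.< j → embed i Fin.< embed j
    embed-vertex : ∀ i → polygon ‼ toℕ (embed i) ≡ u i

complete : ∀ {n} (u : Fin (suc (suc n)) → ℤ²) → (∀ i → Primitive (u i)) →
  (∀ {i j} → i Fin.< j → PosDet (u i) (u j)) → Completion u
complete {n} u prim ascending = record
  { polygon      = u zero ∷ R.rest
  ; closed       = R.unimodular
  ; convex       = positive-rest ∷ convex-if-unimodular {u zero} positive-rest
                     (linked-prefix R.rest (Linked.tail R.unimodular))
  ; embed        = embed
  ; embed-mono   = λ {i} {j} i<j → subst₂ ℕ._<_ (sym (toℕ-embed i)) (sym (toℕ-embed j)) (R.position-mono i<j)
  ; embed-vertex = λ i → trans (cong ((u zero ∷ R.rest) ‼_) (toℕ-embed i)) (R.at-position i)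
  }
  where
  module R = Refinement (refine (primitive-negate {u zero} (prim zero))
                                (suc n) u prim ascending
                                (subst Pos (sym (det-negateʳ (u (Fin.fromℕ (suc n))) (u zero)))
                                           (ascending {zero} {Fin.fromℕ (suc n)} (s≤s z≤n))))
  positive-rest : All (PosDet (u zero)) R.rest
  positive-rest = R.positive₀ (0 , trans (det-negateʳ (u zero) (u zero)) (det-self (u zero)))
  embed : Fin (suc (suc n)) → Fin (suc (length R.rest))
  embed i = Fin.fromℕ< (R.position-< i)
  toℕ-embed : ∀ i → toℕ (embed i) ≡ R.position i
  toℕ-embed i = Finₚ.toℕ-fromℕ< (R.position-< i)

polygonFrieze : (P : List ℤ²) → Labelling (length P)
polygonFrieze P s t = ∣ det (P ‼ toℕ s) (P ‼ toℕ t) ∣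

polygonFrieze-sym : ∀ P s t → polygonFrieze P s t ≡ polygonFrieze P t s
polygonFrieze-sym P s t =
  trans (cong ∣_∣ (det-antisym (P ‼ toℕ t) (P ‼ toℕ s))) (ℤₚ.∣-i∣≡∣i∣ (det (P ‼ toℕ t) (P ‼ toℕ s)))

module _ (P : List ℤ²) (closed : Linked Unimodular (P ++ [ negate (P ‼ 0) ]))
         (convex : AllPairs PosDet P) where

  private
    E = polygonFrieze P

    det-< : ∀ {s t} → s Fin.< t → + E s t ≡ det (P ‼ toℕ s) (P ‼ toℕ t)
    det-< {s} {t} s<t with allPairs-‼ P convex s<t (Finₚ.toℕ<n t)
    ... | k , det≡ = trans (cong (λ d → + ∣ d ∣) det≡) (sym det≡)

    E-positive : ∀ {s t} → s ≢ t → 0 ℕ.< E s t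
    E-positive = wlog-< (λ s t → 0 ℕ.< E s t) (λ {s} {t} _ → subst (0 ℕ.<_) (polygonFrieze-sym P s t))
      (λ {s} {t} s<t → subst (0 ℕ.<_) (cong ∣_∣ (sym (proj₂ (allPairs-‼ P convex s<t (Finₚ.toℕ<n t))))) (s≤s z≤n))

    E-ptolemy : ∀ s t u v → s Fin.< t → t Fin.< u → u Fin.< v →
      E s u ℕ.* E t v ≡ E s v ℕ.* E t u ℕ.+ E s t ℕ.* E u v
    E-ptolemy s t u v s<t t<u u<v = ℤₚ.+-injective (begin
      + (E s u ℕ.* E t v)                     ≡⟨ ℤₚ.pos-* (E s u) (E t v) ⟩
      + E s u * + E t v                       ≡⟨ cong₂ _*_ (det-< s<u) (det-< t<v) ⟩
      det (x s) (x u) * det (x t) (x v)       ≡⟨ plücker (x s) (x t) (x u) (x v) ⟩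
      det (x s) (x v) * det (x t) (x u) + det (x s) (x t) * det (x u) (x v)
        ≡⟨ cong₂ _+_ (cong₂ _*_ (det-< s<v) (det-< t<u)) (cong₂ _*_ (det-< s<t) (det-< u<v)) ⟨
      + E s v * + E t u + + E s t * + E u v   ≡⟨ pos-*+* (E s v) (E t u) (E s t) (E u v) ⟨
      + (E s v ℕ.* E t u ℕ.+ E s t ℕ.* E u v) ∎)
      where
      x : Fin (length P) → ℤ²
      x s = P ‼ toℕ s
      s<u = Finₚ.<-trans s<t t<u
      t<v = Finₚ.<-trans t<u u<v
      s<v = Finₚ.<-trans s<u u<v

    closed-‼ : ∀ {k} → k ℕ.< length P →
      Unimodular ((P ++ [ negate (P ‼ 0) ]) ‼ k) ((P ++ [ negate (P ‼ 0) ]) ‼ suc k)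
    closed-‼ k< = linked-‼ (P ++ [ negate (P ‼ 0) ]) closed
      (subst (λ m → _ ℕ.< m) (trans (ℕₚ.+-comm 1 (length P)) (sym (Listₚ.length-++ P))) (s≤s k<))

    E-boundary : ∀ s t → IsBoundaryEdge (length P) s t → E s t ≡ 1
    E-boundary s t (inj₁ t≡1+s) = cong ∣_∣ (begin
      det (P ‼ toℕ s) (P ‼ toℕ t)                 ≡⟨ cong (λ k → det (P ‼ toℕ s) (P ‼ k)) t≡1+s ⟩
      det (P ‼ toℕ s) (P ‼ suc (toℕ s))           ≡⟨ cong₂ det (‼-++ˡ P _ s<) (‼-++ˡ P _ 1+s<) ⟨
      det ((P ++ _) ‼ toℕ s) ((P ++ _) ‼ suc (toℕ s)) ≡⟨ closed-‼ s< ⟩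
      + 1                                          ∎)
      where
      1+s< : suc (toℕ s) ℕ.< length P
      1+s< = subst (ℕ._< length P) t≡1+s (Finₚ.toℕ<n t)
      s< : toℕ s ℕ.< length P
      s< = ℕₚ.<-trans (ℕₚ.n<1+n (toℕ s)) 1+s<
    E-boundary s t (inj₂ (s≡0 , t≡m-1)) = cong ∣_∣ (begin
      det (P ‼ toℕ s) (P ‼ toℕ t)             ≡⟨ cong₂ (λ i j → det (P ‼ i) (P ‼ j)) s≡0 t≡m-1 ⟩
      det (P ‼ 0) (P ‼ last)                  ≡⟨ det-negateʳ (P ‼ last) (P ‼ 0) ⟨
      det (P ‼ last) (negate (P ‼ 0))         ≡⟨ cong₂ det (‼-++ˡ P _ last<) (‼-++ʳ-last) ⟨
      det ((P ++ _) ‼ last) ((P ++ _) ‼ suc last) ≡⟨ closed-‼ last< ⟩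
      + 1                                      ∎)
      where
      last = length P ℕ.∸ 1
      1+last≡m : suc last ≡ length P
      1+last≡m = ℕₚ.suc-pred (length P) ⦃ ℕ.>-nonZero (ℕₚ.≤-<-trans z≤n (Finₚ.toℕ<n s)) ⦄
      last< : last ℕ.< length P
      last< = ℕₚ.≤-reflexive 1+last≡m
      ‼-++ʳ-last : (P ++ [ negate (P ‼ 0) ]) ‼ suc last ≡ negate (P ‼ 0)
      ‼-++ʳ-last = trans (cong ((P ++ [ negate (P ‼ 0) ]) ‼_) (trans 1+last≡m (sym (ℕₚ.+-identityʳ (length P)))))
                         (‼-++ʳ P [ negate (P ‼ 0) ] 0)

  polygonFrieze-conwayCoxeter : IsConwayCoxeter (length P) (polygonFrieze P)
  polygonFrieze-conwayCoxeter = record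
    { frieze   = record { symmetric = λ s t _ → polygonFrieze-sym P s t ; positive = λ _ _ → E-positive ; ptolemy = E-ptolemy }
    ; boundary = E-boundary
    }

module _ {n} {c : Labelling n} (fr : IsFrieze n c) (R : Realisation (signed c))
         (C : Completion (Realisation.vectors R)) where
  open IsFrieze fr
  open Realisation R
  open Completion C

  labels-scaled : ∀ i j → i ≢ j → c i j ≡ suc k ℕ.* polygonFrieze polygon (embed i) (embed j)
  labels-scaled i j = wlog-< (λ i j → c i j ≡ suc k ℕ.* polygonFrieze polygon (embed i) (embed j)) flip base
    where
    flip : ∀ {i j} → i ≢ j → c i j ≡ suc k ℕ.* polygonFrieze polygon (embed i) (embed j) →
           c j i ≡ suc k ℕ.* polygonFrieze polygon (embed j) (embed i)
    flip {i} {j} i≢j eq = trans (symmetric j i (i≢j ∘ sym))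
      (trans eq (cong (suc k ℕ.*_) (polygonFrieze-sym polygon (embed i) (embed j))))
    base : ∀ {i j} → i Fin.< j → c i j ≡ suc k ℕ.* polygonFrieze polygon (embed i) (embed j)
    base {i} {j} i<j = ℤₚ.+-injective (begin
      + c i j                                                     ≡⟨ signed-< c i<j ⟨
      signed c i j                                                ≡⟨ realises i j ⟩
      +[1+ k ] * det (vectors i) (vectors j)                      ≡⟨ cong (+[1+ k ] *_) det≡∣det∣ ⟩
      +[1+ k ] * + ∣ det (vectors i) (vectors j) ∣                ≡⟨ ℤₚ.pos-* (suc k) _ ⟨
      + (suc k ℕ.* ∣ det (vectors i) (vectors j) ∣)               ≡⟨ cong (λ d → + (suc k ℕ.* ∣ d ∣))
                                                                       (cong₂ det (embed-vertex i) (embed-vertex j)) ⟨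
      + (suc k ℕ.* polygonFrieze polygon (embed i) (embed j))     ∎)
      where
      det≡∣det∣ : det (vectors i) (vectors j) ≡ + ∣ det (vectors i) (vectors j) ∣
      det≡∣det∣ with realisation-det-positive fr R i<j
      ... | _ , det≡ = trans det≡ (cong (λ d → + ∣ d ∣) (sym det≡))

mainTheorem2 : (n : ℕ) → 3 ℕ.≤ n → (c : Labelling n) →
    IsFrieze n c → TriangleGcdCondition n c →
    Σ ℕ λ m → Σ (Labelling m) λ e → Σ ℕ λ k →
    IsConwayCoxeter m e × 0 ℕ.< k × IsSubpolygonOf c (scale k e)
mainTheorem2 _ (s≤s (s≤s (s≤s _))) c fr tg =
  length polygon , polygonFrieze polygon , suc k ,
  polygonFrieze-conwayCoxeter polygon closed convex , s≤s z≤n ,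
  embed , (λ _ _ → embed-mono) , labels-scaled fr R C
  where
  R = frieze-realisation fr
  open Realisation R
  C = complete vectors (realisation-primitive fr R tg) (realisation-det-positive fr R)
  open Completion C
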